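{- Let $n\ge 2$, $s\ge2$, let $B$ be a set with $n/s$ elements, and let $R=X\times Y\subseteq B^s\times B^s$ be a rectangle containing a square $(I,S,\mathcal{A})$ such that $I\neq\emptyset$ and $S$ is $r$-thick with $r=10\log n$. Then $R$ is not monochromatic for $s$-UEQUAL, i.e. $R$ contains both an instance of $B_0^{(s)}$ and an instance of $B_*^{(s)}$.
   Context: $s$-UEQUAL: \textsf{no} instances $B_{0}^{(s)}:=\{(x,y)\in B^s\times B^s: \forall i \in [s],\ x_i \neq y_i\}$; \textsf{yes} instances $B_{*}^{(s)}:=\{(x,y)\in B^s\times B^s: \exists \ell,\ x_{\ell} = y_{\ell} \text{ and } \forall i\neq \ell,\ x_i \neq y_i \}$. A square in $R=X\times Y$ is a triple $(I,S,\mathcal{A})$ with $I\subseteq[s]$, $S\subseteq B^I$, and $\mathcal{A}=\{A_i\subseteq B: i\in[s]\setminus I\}$, such that for every $z\in S$ there exist $x\in X$ and $y\in Y$ with $x|_I=z$, $x_i\in A_i$ for all $i\in[s]\setminus I$, and $y|_I=z$, $y_i\in B\setminus A_i$ for all $i\in[s]\setminus I$. A set $S\subseteq B^I$ is $r$-thick if it is nonempty and for every $i\in I$ and $x\in S$, $|\{x'\in S: \forall j\in I\setminus\{i\},\ x'_j=x_j\}|\ge r$; a square is $r$-thick if $S$ is. Logarithms are base $2$. -}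

module Defs where

open import Data.Nat using (ℕ; _^_; _≤_)
open import Data.Fin using (Fin)
open import Data.Fin.Subset using (Subset; _∈_; _∉_)
open import Data.Product using (Σ; ∃; _×_; _,_)
open import Relation.Binary.PropositionalEquality using (_≡_)
open import Relation.Nullary using (¬_)

-- Points of B^s, with B = Fin m (a set with m = n/s elements).
Pt : ℕ → ℕ → Set
Pt s m = Fin s → Fin m

PtI : (s m : ℕ) → Subset s → Set
PtI s m I = (i : Fin s) → i ∈ I → Fin m

_≈I_ : ∀ {s m I} → PtI s m I → PtI s m I → Set
_≈I_ {s} {m} {I} z w = (i : Fin s) (p : i ∈ I) → z i p ≡ w i p

AtLeast : ∀ {s m I} → ℕ → (PtI s m I → Set) → Set
AtLeast {s} {m} {I} c P =
  Σ (Fin c → PtI s m I) λ f →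
    ((a : Fin c) → P (f a)) × ((a b : Fin c) → f a ≈I f b → a ≡ b)

-- |P| ≥ 10 log₂ n  (real threshold), expressed exactly in ℕ:
-- a natural c satisfies c ≥ 10 log₂ n iff n^10 ≤ 2^c.
AtLeast10Log : ∀ {s m I} → ℕ → (PtI s m I → Set) → Set
AtLeast10Log {s} {m} {I} n P = ∃ λ c → (n ^ 10 ≤ 2 ^ c) × AtLeast {s} {m} {I} c P

Thick10Log : ∀ {s m} (n : ℕ) (I : Subset s) → (PtI s m I → Set) → Set
Thick10Log {s} {m} n I S =
  (∃ λ z → S z) ×
  ((i : Fin s) → i ∈ I → (x : PtI s m I) → S x →
     AtLeast10Log {s} {m} {I} n
       (λ x' → S x' × ((j : Fin s) (p : j ∈ I) → ¬ (j ≡ i) → x' j p ≡ x j p)))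

IsSquare : ∀ {s m} (X Y : Pt s m → Set) (I : Subset s) (S : PtI s m I → Set)
           (A : (i : Fin s) → i ∉ I → Fin m → Set) → Set
IsSquare {s} {m} X Y I S A =
  (z : PtI s m I) → S z →
    (∃ λ (x : Pt s m) → X x
        × ((i : Fin s) (p : i ∈ I) → x i ≡ z i p)
        × ((i : Fin s) (q : i ∉ I) → A i q (x i)))
  × (∃ λ (y : Pt s m) → Y y
        × ((i : Fin s) (p : i ∈ I) → y i ≡ z i p)
        × ((i : Fin s) (q : i ∉ I) → ¬ A i q (y i)))

B₀ : ∀ {s m} → Pt s m → Pt s m → Set
B₀ {s} x y = (i : Fin s) → ¬ (x i ≡ y i)

B* : ∀ {s m} → Pt s m → Pt s m → Set
B* {s} x y = ∃ λ (ℓ : Fin s) → (x ℓ ≡ y ℓ) × ((i : Fin s) → ¬ (i ≡ ℓ) → ¬ (x i ≡ y i))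

{-# OPTIONS --safe #-}
module Submission where

-- Thickness 10 log n ≥ 2 means that every point of S has, in every direction i ∈ I, a
-- neighbour in S that differs from it exactly at coordinate i.  Walking from z ∈ S through
-- such neighbours, one coordinate at a time, reaches w ∈ S that differs from z on any
-- prescribed set T of coordinates and agrees with z elsewhere.  The square lifts z and w to
-- x ∈ X and y ∈ Y with x_i ∈ A_i ∌ y_i off I, so x and y agree exactly on I ∖ T.  Taking
-- T = I gives a no-instance, T = [s] ∖ {ℓ} with ℓ ∈ I a yes-instance.

open import Defs
open import Data.Nat using (ℕ; _*_; _≤_; _^_; z≤n; s≤s)
open import Data.Nat.Properties using (≤-trans; ≮⇒≥; <⇒≱; ^-monoˡ-≤; ^-monoʳ-≤; ^-monoʳ-<)
open import Data.Fin using (Fin; zero; suc; _≟_)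
open import Data.Fin.Subset using (Subset; _∈_; _∉_; Nonempty)
open import Data.Fin.Subset.Properties using () renaming (_∈?_ to _∈ₛ?_)
open import Data.List using (List; []; _∷_; filter; allFin)
open import Data.List.Relation.Unary.Any using (here; there)
open import Data.List.Membership.Propositional using () renaming (_∈_ to _∈ₗ_; _∉_ to _∉ₗ_)
open import Data.List.Membership.Propositional.Properties using (∈-filter⁺; ∈-filter⁻; ∈-allFin)
import Data.List.Membership.DecPropositional as DecMembership
open import Data.Vec.Properties.WithK using ([]=-irrelevant)
open import Data.Product using (∃; _×_; _,_; proj₁; proj₂)
open import Data.Sum using (_⊎_; inj₁; inj₂; [_,_]′)
open import Data.Empty using (⊥-elim)
open import Function using (_∘_)
open import Relation.Unary using (Pred; Decidable)
open import Relation.Nullary using (¬_; yes; no; ¬?)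
open import Relation.Binary.PropositionalEquality using (_≡_; _≢_; refl; sym; trans; cong; subst)

thickness≥2 : ∀ {n c} → 2 ≤ n → n ^ 10 ≤ 2 ^ c → 2 ≤ c
thickness≥2 {n} {c} 2≤n n¹⁰≤2ᶜ = ≮⇒≥ λ c<2 →
  <⇒≱ (^-monoʳ-< 2 (s≤s (s≤s z≤n)) c<2)
      (≤-trans (^-monoʳ-≤ 2 {2} {10} (s≤s (s≤s z≤n))) (≤-trans (^-monoˡ-≤ 10 2≤n) n¹⁰≤2ᶜ))

module _ {s m : ℕ} {I : Subset s} where

  open DecMembership (_≟_ {s}) using () renaming (_∈?_ to _∈ₗ?_)

  ∈-irrelevant-at : (x : PtI s m I) {i : Fin s} (p q : i ∈ I) → x i p ≡ x i q
  ∈-irrelevant-at x p q = cong (x _) ([]=-irrelevant p q)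

  differsAt-irrelevant : (x x' : PtI s m I) {i : Fin s} (q : i ∈ I) →
    x' i q ≢ x i q → (p : i ∈ I) → x' i p ≢ x i p
  differsAt-irrelevant x x' q x'≢x p e =
    x'≢x (trans (∈-irrelevant-at x' q p) (trans e (∈-irrelevant-at x p q)))

  AgreeOff : Fin s → PtI s m I → PtI s m I → Set
  AgreeOff i x x' = (j : Fin s) (p : j ∈ I) → j ≢ i → x' j p ≡ x j p

  DiffersExactlyOn : Pred (Fin s) _ → PtI s m I → PtI s m I → Set
  DiffersExactlyOn T z w =
    ((j : Fin s) (p : j ∈ I) → T j → w j p ≢ z j p) ×
    ((j : Fin s) (p : j ∈ I) → ¬ T j → w j p ≡ z j p)

  module _ (S : PtI s m I → Set) where

    Neighbour : Fin s → PtI s m I → PtI s m I → Set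
    Neighbour i x x' = S x' × ((p : i ∈ I) → x' i p ≢ x i p) × AgreeOff i x x'

    -- Two distinct points on the line through x in direction i cannot both equal x at i.
    neighbour-on-line : ∀ {c i x} → 2 ≤ c → i ∈ I →
      AtLeast c (λ x' → S x' × AgreeOff i x x') → ∃ (Neighbour i x)
    neighbour-on-line {i = i} {x} (s≤s (s≤s _)) q (f , onLine , injective)
      with f zero i q ≟ x i q | f (suc zero) i q ≟ x i q
    ... | no f₀≢x | _ =
      f zero , proj₁ (onLine zero) , differsAt-irrelevant x (f zero) q f₀≢x , proj₂ (onLine zero)
    ... | yes _ | no f₁≢x =
      f (suc zero) , proj₁ (onLine (suc zero)) , differsAt-irrelevant x (f (suc zero)) q f₁≢x ,
      proj₂ (onLine (suc zero))
    ... | yes f₀≡x | yes f₁≡x with injective zero (suc zero) f₀≈f₁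
      where
      f₀≈f₁ : f zero ≈I f (suc zero)
      f₀≈f₁ j p with j ≟ i
      ... | yes refl = trans (∈-irrelevant-at (f zero) p q)
                         (trans f₀≡x (trans (sym f₁≡x) (∈-irrelevant-at (f (suc zero)) q p)))
      ... | no j≢i = trans (proj₂ (onLine zero) j p j≢i) (sym (proj₂ (onLine (suc zero)) j p j≢i))
    ... | ()

    thick⇒neighbour : ∀ {n} → 2 ≤ n → Thick10Log n I S →
      ∀ {i x} → i ∈ I → S x → ∃ (Neighbour i x)
    thick⇒neighbour 2≤n (_ , thick) {i} {x} q Sx with thick i q x Sx
    ... | c , n¹⁰≤2ᶜ , line = neighbour-on-line (thickness≥2 2≤n n¹⁰≤2ᶜ) q line

    module Spread (step : ∀ {i x} → i ∈ I → S x → ∃ (Neighbour i x)) {z : PtI s m I} (Sz : S z) where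

      differsOn-cons-trivial : ∀ {j js w} → j ∈ₗ js ⊎ j ∉ I →
        DiffersExactlyOn (_∈ₗ js) z w → DiffersExactlyOn (_∈ₗ j ∷ js) z w
      differsOn-cons-trivial {j} {js} {w} redundant (moved , fixed) =
        moved′ , λ k p k∉ → fixed k p (k∉ ∘ there)
        where
        moved′ : (k : Fin s) (p : k ∈ I) → k ∈ₗ j ∷ js → w k p ≢ z k p
        moved′ k p (there k∈js) = moved k p k∈js
        moved′ k p (here refl) = [ moved k p , (λ j∉I → ⊥-elim (j∉I p)) ]′ redundant

      differsOn-cons-neighbour : ∀ {j js w w′} → j ∉ₗ js →
        DiffersExactlyOn (_∈ₗ js) z w → Neighbour j w w′ → DiffersExactlyOn (_∈ₗ j ∷ js) z w′
      differsOn-cons-neighbour {j} {js} {w} {w′} j∉js (moved , fixed) (_ , w′≢w , w′≈w) =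
        moved′ , λ k p k∉ → trans (w′≈w k p (k∉ ∘ here)) (fixed k p (k∉ ∘ there))
        where
        moved′ : (k : Fin s) (p : k ∈ I) → k ∈ₗ j ∷ js → w′ k p ≢ z k p
        moved′ k p (here refl) e = w′≢w p (trans e (sym (fixed k p j∉js)))
        moved′ k p (there k∈js) e =
          moved k p k∈js (trans (sym (w′≈w k p λ { refl → j∉js k∈js })) e)

      spreadAlong : (js : List (Fin s)) → ∃ λ w → S w × DiffersExactlyOn (_∈ₗ js) z w
      spreadAlong [] = z , Sz , (λ _ _ ()) , (λ _ _ _ → refl)
      spreadAlong (j ∷ js) with spreadAlong js | j ∈ₗ? js | j ∈ₛ? I
      ... | w , Sw , d | yes j∈js | _     = w , Sw , differsOn-cons-trivial (inj₁ j∈js) d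
      ... | w , Sw , d | no _     | no j∉I = w , Sw , differsOn-cons-trivial (inj₂ j∉I) d
      ... | w , Sw , d | no j∉js  | yes q with step q Sw
      ...   | w′ , n = w′ , proj₁ n , differsOn-cons-neighbour j∉js d n

      spread : {T : Pred (Fin s) _} → Decidable T → ∃ λ w → S w × DiffersExactlyOn T z w
      spread {T} T? with spreadAlong (filter T? (allFin s))
      ... | w , Sw , moved , fixed =
        w , Sw , (λ j p t → moved j p (∈-filter⁺ T? (∈-allFin j) t))
                , (λ j p ¬t → fixed j p (¬t ∘ proj₂ ∘ ∈-filter⁻ T? {xs = allFin s}))

AgreeExactlyOn : ∀ {s m} → Pred (Fin s) _ → Pt s m → Pt s m → Set
AgreeExactlyOn {s} P x y = ((i : Fin s) → x i ≡ y i → P i) × ((i : Fin s) → P i → x i ≡ y i)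

module _ {s m : ℕ} {X Y : Pt s m → Set} {I : Subset s} {S : PtI s m I → Set}
         {A : (i : Fin s) → i ∉ I → Fin m → Set} (square : IsSquare X Y I S A) where

  lift-pair : ∀ {T z w} → S z → S w → DiffersExactlyOn T z w →
    ∃ λ x → ∃ λ y → X x × Y y × AgreeExactlyOn (λ i → i ∈ I × ¬ T i) x y
  lift-pair {T} {z} {w} Sz Sw (moved , fixed)
    with proj₁ (square z Sz) | proj₂ (square w Sw)
  ... | x , Xx , x≡z , x∈A | y , Yy , y≡w , y∉A = x , y , Xx , Yy , agree⇒ , ⇒agree
    where
    agree⇒ : (i : Fin s) → x i ≡ y i → i ∈ I × ¬ T i
    agree⇒ i x≡y with i ∈ₛ? I
    ... | yes p = p , λ t → moved i p t (trans (sym (y≡w i p)) (trans (sym x≡y) (x≡z i p)))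
    ... | no q  = ⊥-elim (y∉A i q (subst (A i q) x≡y (x∈A i q)))
    ⇒agree : (i : Fin s) → i ∈ I × ¬ T i → x i ≡ y i
    ⇒agree i (p , ¬t) = trans (x≡z i p) (trans (sym (fixed i p ¬t)) (sym (y≡w i p)))

  pair-agreeing-exactly-on-I∖ : (∀ {i x} → i ∈ I → S x → ∃ (Neighbour S i x)) → ∃ S →
    ∀ {T} → Decidable T → ∃ λ x → ∃ λ y → X x × Y y × AgreeExactlyOn (λ i → i ∈ I × ¬ T i) x y
  pair-agreeing-exactly-on-I∖ step (z , Sz) T? =
    let w , Sw , d = Spread.spread S step Sz T? in lift-pair Sz Sw d

corollary5p6 : (n s m : ℕ) → 2 ≤ n → 2 ≤ s → m * s ≡ n →
    (X Y : Pt s m → Set) →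
    (I : Subset s) (S : PtI s m I → Set) (A : (i : Fin s) → i ∉ I → Fin m → Set) →
    IsSquare X Y I S A → Nonempty I → Thick10Log n I S →
    (∃ λ x → ∃ λ y → X x × Y y × B₀ x y) × (∃ λ x → ∃ λ y → X x × Y y × B* x y)
corollary5p6 n s m 2≤n _ _ X Y I S A square (ℓ , ℓ∈I) thick = noInstance , yesInstance
  where
  pair = pair-agreeing-exactly-on-I∖ {A = A} square (thick⇒neighbour S 2≤n thick) (proj₁ thick)

  noInstance : ∃ λ x → ∃ λ y → X x × Y y × B₀ x y
  noInstance with pair (_∈ₛ? I)
  ... | x , y , Xx , Yy , agree⇒ , _ =
    x , y , Xx , Yy , λ i x≡y → let i∈I , i∉I = agree⇒ i x≡y in i∉I i∈I

  yesInstance : ∃ λ x → ∃ λ y → X x × Y y × B* x y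
  yesInstance with pair (λ j → ¬? (j ≟ ℓ))
  ... | x , y , Xx , Yy , agree⇒ , ⇒agree =
    x , y , Xx , Yy , ℓ , ⇒agree ℓ (ℓ∈I , λ ℓ≢ℓ → ℓ≢ℓ refl) , λ i i≢ℓ x≡y → proj₂ (agree⇒ i x≡y) i≢ℓ
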